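{- For all checkers terms $t,u$: if $t \sqsubseteq^{\mathrm{pwc}} u$ then $C[t]\sqsubseteq^{\mathrm{pwc}} C[u]$ for every checkers context $C$.
   Context: Checkers terms: $t ::= x \mid \lambda_c x.t \mid t\cdot^{c} u$ with $c\in\{\circ,\bullet\}$; checkers contexts $C$ are arbitrary colored one-hole contexts (hole may capture variables). Colored multi types: linear types $L ::= X \mid M\to_c L$, multi types $M=[L_1,\dots,L_n]$; judgments $\Gamma\vdash^k t:L$ with rules: $x:[L]\vdash^0 x:L$; many: from $(\Gamma_i\vdash^{k_i} t:L_i)_{i\in I}$ infer $\uplus_i\Gamma_i\vdash^{\sum_i k_i} t:[L_i]_{i\in I}$; from $\Gamma,x:M\vdash^k t:L$ infer $\Gamma\vdash^k\lambda_c x.t: M\to_c L$; from $\Gamma\vdash^{k_1}t:M\to_c L$ and $\Delta\vdash^{k_2}u:M$ infer $\Gamma\uplus\Delta\vdash^{k}t\cdot^{d}u:L$ where $k=k_1+k_2$ if $c=d$, else $k_1+k_2+1$. Interpretation $[\![t]\!]=\{(\Gamma,L,k)\mid \Gamma\vdash^k t:L\}$. Polarized whitening $\le^{p}_k$ ($p\in\{+,-\}$, $\bar p$ opposite): $X\le^p_0 X$; $M'\to_\circ L'\le^+_{k_1+k_2+1} M\to_\bullet L$ if $M'\le^-_{k_1}M$ and $L'\le^+_{k_2}L$; $M'\to_c L'\le^p_{k_1+k_2} M\to_c L$ if $M'\le^{\bar p}_{k_1}M$ and $L'\le^p_{k_2}L$; multisets pointwise with summed indices; environments pointwise; $(\Gamma',L')\le^p_{k_1+k_2}(\Gamma,L)$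 if $\Gamma'\le^{\bar p}_{k_1}\Gamma$ and $L'\le^p_{k_2}L$. $t\sqsubseteq^{\mathrm{pwc}}u$ iff for every $(\Gamma,L,k)\in[\![t]\!]$ there exist $(\Gamma',L',k')\in[\![u]\!]$ and $d$ with $(\Gamma',L')\le^+_d(\Gamma,L)$ and $k\ge k'+d$. -}

module Defs where

open import Data.Nat using (ℕ; zero; suc; _+_; _≤_)
open import Data.List using (List; []; _∷_; _++_)
open import Data.Product using (Σ; _×_; _,_; ∃-syntax)
open import Relation.Binary.PropositionalEquality using (_≡_)
open import Relation.Nullary using (Dec; yes; no)
open import Data.Nat using (_≟_)

data Color : Set where
  ∘ • : Color

Var : Set
Var = ℕ

-- checkers terms (named variables, so that contexts may capture)
data Term : Set where
  var : Var → Term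
  lam : Color → Var → Term → Term
  app : Color → Term → Term → Term      -- app c t u  is  t ·^c u

data Ctx : Set where
  hole : Ctx
  lamC : Color → Var → Ctx → Ctx
  appL : Color → Ctx → Term → Ctx
  appR : Color → Term → Ctx → Ctx

-- plugging: plain syntactic replacement (variables may be captured)
plug : Ctx → Term → Term
plug hole t = t
plug (lamC c x C) t = lam c x (plug C t)
plug (appL c C u) t = app c (plug C t) u
plug (appR c u C) t = app c u (plug C t)

-- Colored multi types (multisets represented by lists, taken modulo
-- permutation, see _≈L_ / _≈M_ below)

Atom : Set
Atom = ℕ

data Lin : Set where
  at  : Atom → Lin
  arr : List Lin → Color → Lin → Lin    -- arr M c L  is  M →_c L

Multi : Set
Multi = List Lin

data Select {A : Set} : A → List A → List A → Set where
  here  : ∀ {x xs} → Select x (x ∷ xs) xs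
  there : ∀ {x y xs ys} → Select x xs ys → Select x (y ∷ xs) (y ∷ ys)

mutual
  data _≈L_ : Lin → Lin → Set where
    at≈  : ∀ {X} → at X ≈L at X
    arr≈ : ∀ {M M' c L L'} → M ≈M M' → L ≈L L' → arr M c L ≈L arr M' c L'

  data _≈M_ : Multi → Multi → Set where
    []≈ : [] ≈M []
    ∷≈  : ∀ {L L' M N N'} → L ≈L L' → Select L' N N' → M ≈M N' → (L ∷ M) ≈M N

-- Typing environments: total maps, [] meaning "not in the domain"

Env : Set
Env = Var → Multi

∅ : Env
∅ _ = []

single : Var → Lin → Env
single x L y with x ≟ y
... | yes _ = L ∷ []
... | no  _ = []

_⊎_ : Env → Env → Env
(Γ ⊎ Δ) x = Γ x ++ Δ x

_∖_ : Env → Var → Env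
(Γ ∖ x) y with x ≟ y
... | yes _ = []
... | no  _ = Γ y

_≈E_ : Env → Env → Set
Γ ≈E Δ = ∀ x → Γ x ≈M Δ x

cost : Color → Color → ℕ
cost ∘ ∘ = 0
cost • • = 0
cost ∘ • = 1
cost • ∘ = 1

mutual
  data _⊢[_]_∶_ : Env → ℕ → Term → Lin → Set where
    ax   : ∀ {x L} → single x L ⊢[ 0 ] var x ∶ L
    abs  : ∀ {Γ k c x t L} → Γ ⊢[ k ] t ∶ L → (Γ ∖ x) ⊢[ k ] lam c x t ∶ arr (Γ x) c L
    appT : ∀ {Γ Δ k₁ k₂ c d t u M L} →
           Γ ⊢[ k₁ ] t ∶ arr M c L → Δ ⊢M[ k₂ ] u ∶ M →
           (Γ ⊎ Δ) ⊢[ k₁ + k₂ + cost c d ] app d t u ∶ L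
    -- multisets are taken modulo (deep) permutation
    conv : ∀ {Γ Γ' k t L L'} → Γ ⊢[ k ] t ∶ L → Γ ≈E Γ' → L ≈L L' → Γ' ⊢[ k ] t ∶ L'

  -- the "many" rule, for a finite family indexed by list positions
  data _⊢M[_]_∶_ : Env → ℕ → Term → Multi → Set where
    many[] : ∀ {t} → ∅ ⊢M[ 0 ] t ∶ []
    many∷  : ∀ {Γ Δ k₁ k₂ t L M} → Γ ⊢[ k₁ ] t ∶ L → Δ ⊢M[ k₂ ] t ∶ M →
             (Γ ⊎ Δ) ⊢M[ k₁ + k₂ ] t ∶ (L ∷ M)

⟦_⟧ : Term → Env → Lin → ℕ → Set
⟦ t ⟧ Γ L k = Γ ⊢[ k ] t ∶ L

data Pol : Set where
  ⁺ ⁻ : Pol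

opp : Pol → Pol
opp ⁺ = ⁻
opp ⁻ = ⁺

mutual
  -- LLe p k L' L  is  L' ≤^p_k L
  data LLe : Pol → ℕ → Lin → Lin → Set where
    atLe   : ∀ {p X} → LLe p 0 (at X) (at X)
    flipLe : ∀ {k₁ k₂ M' M L' L} → MLe ⁻ k₁ M' M → LLe ⁺ k₂ L' L →
             LLe ⁺ (k₁ + k₂ + 1) (arr M' ∘ L') (arr M • L)
    sameLe : ∀ {p k₁ k₂ c M' M L' L} → MLe (opp p) k₁ M' M → LLe p k₂ L' L →
             LLe p (k₁ + k₂) (arr M' c L') (arr M c L)

  -- multisets: pointwise (via a bijection), indices summed
  data MLe : Pol → ℕ → Multi → Multi → Set where
    []Le : ∀ {p} → MLe p 0 [] []
    ∷Le  : ∀ {p k₁ k₂ L' L M' N N'} → LLe p k₁ L' L → Select L N N' → MLe p k₂ M' N' →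
           MLe p (k₁ + k₂) (L' ∷ M') N

-- environments: pointwise over the (finite) support, indices summed
data EnvLeBelow (p : Pol) (Γ' Γ : Env) : ℕ → ℕ → Set where
  base : EnvLeBelow p Γ' Γ 0 0
  step : ∀ {n k₁ k₂} → EnvLeBelow p Γ' Γ n k₁ → MLe p k₂ (Γ' n) (Γ n) →
         EnvLeBelow p Γ' Γ (suc n) (k₁ + k₂)

EnvLe : Pol → ℕ → Env → Env → Set
EnvLe p k Γ' Γ = ∃[ n ] (EnvLeBelow p Γ' Γ n k × (∀ x → n ≤ x → (Γ' x ≡ []) × (Γ x ≡ [])))

-- (Γ', L') ≤^p_k (Γ, L)
data PairLe (p : Pol) : ℕ → Env × Lin → Env × Lin → Set where
  pairLe : ∀ {k₁ k₂ Γ' Γ L' L} → EnvLe (opp p) k₁ Γ' Γ → LLe p k₂ L' L →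
           PairLe p (k₁ + k₂) (Γ' , L') (Γ , L)

_⊑pwc_ : Term → Term → Set
t ⊑pwc u = ∀ Γ L k → ⟦ t ⟧ Γ L k →
  ∃[ Γ' ] ∃[ L' ] ∃[ k' ] ∃[ d ]
    (⟦ u ⟧ Γ' L' k' × PairLe ⁺ d (Γ' , L') (Γ , L) × (k' + d ≤ k))

-- ⊑pwc is not directly a congruence: under an abstraction the environment of the hole moves into
-- the negative domain of an arrow, and under an application the argument type has to fit the
-- domain of the function. One therefore proves a stronger simulation t ⊑ʷ u: every typing of t,
-- together with any negative whitening of its interface, is matched by a typing of u whose
-- interface is a positive whitening of the whitened one, at no greater total cost. This relation
-- is a congruence: variables and abstractions just transport the whitenings, and in an application
-- the function and the argument are whitened alternately until domain and argument type agree.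
-- Reflexivity of ⊑ʷ and the diamond property of whitenings (a negative and a positive whitening of
-- the same type commute) give ⊑pwc ⇒ ⊑ʷ; the converse is the instance with no whitening.

{-# OPTIONS --safe #-}
module Submission where

open import Defs
open import Data.Empty using (⊥-elim)
open import Data.List using ([]; _∷_; _++_)
open import Data.List.Properties using (++-conicalˡ; ++-conicalʳ; ++-identityʳ)
open import Data.Nat using (ℕ; zero; suc; _+_; _≤_; _<_; z≤n; z<s; _⊔_; _≟_; _<?_)
open import Data.Nat.Induction using (<-wellFounded)
open import Data.Nat.Properties
open import Algebra.Properties.CommutativeSemigroup +-commutativeSemigroup
  using (interchange; x∙yz≈y∙xz; xy∙z≈xz∙y)
open import Data.Nat.Tactic.RingSolver using (solve; solve-∀)
open import Data.Product using (∃-syntax; _×_; _,_; proj₁; proj₂)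
open import Data.Sum using (inj₁; inj₂) renaming (_⊎_ to _⊎′_)
open import Induction.WellFounded using (Acc; acc)
open import Relation.Binary.PropositionalEquality
open import Relation.Nullary using (yes; no)

select-++ʳ : ∀ {X : Set} {x : X} {xs ys} zs → Select x xs ys → Select x (xs ++ zs) (ys ++ zs)
select-++ʳ zs here      = here
select-++ʳ zs (there s) = there (select-++ʳ zs s)

select-swap : ∀ {X : Set} {x y : X} {xs ys zs} → Select x xs ys → Select y ys zs →
              ∃[ ws ] (Select y xs ws × Select x ws zs)
select-swap here      s         = _ , there s , here
select-swap (there s) here      = _ , here , s
select-swap (there s) (there t) with select-swap s t
... | ws , s' , t' = _ ∷ ws , there s' , there t'

select-same-or-swap : ∀ {X : Set} {x y : X} {xs ys zs} → Select x xs ys → Select y xs zs →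
                      (x ≡ y × ys ≡ zs) ⊎′ ∃[ ws ] (Select y ys ws × Select x zs ws)
select-same-or-swap here      here      = inj₁ (refl , refl)
select-same-or-swap here      (there t) = inj₂ (_ , t , here)
select-same-or-swap (there s) here      = inj₂ (_ , here , s)
select-same-or-swap (there s) (there t) with select-same-or-swap s t
... | inj₁ (refl , refl)  = inj₁ (refl , refl)
... | inj₂ (ws , s' , t') = inj₂ (_ ∷ ws , there s' , there t')

-- Whitening of types

LLe-cast : ∀ {p k l L' L} → LLe p k L' L → k ≡ l → LLe p l L' L
LLe-cast w refl = w

MLe-cast : ∀ {p k l M' M} → MLe p k M' M → k ≡ l → MLe p l M' M
MLe-cast w refl = w

mutual
  LLe-refl : ∀ {p} L → LLe p 0 L L
  LLe-refl (at X)      = atLe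
  LLe-refl (arr M c L) = sameLe (MLe-refl M) (LLe-refl L)

  MLe-refl : ∀ {p} M → MLe p 0 M M
  MLe-refl []      = []Le
  MLe-refl (L ∷ M) = ∷Le (LLe-refl L) here (MLe-refl M)

mutual
  ≈L⇒LLe : ∀ {p L' L} → L' ≈L L → LLe p 0 L' L
  ≈L⇒LLe at≈         = atLe
  ≈L⇒LLe (arr≈ m l)  = sameLe (≈M⇒MLe m) (≈L⇒LLe l)

  ≈M⇒MLe : ∀ {p M' M} → M' ≈M M → MLe p 0 M' M
  ≈M⇒MLe []≈         = []Le
  ≈M⇒MLe (∷≈ l s m)  = ∷Le (≈L⇒LLe l) s (≈M⇒MLe m)

mutual
  LLe⇒≈L : ∀ {p k L' L} → LLe p k L' L → k ≡ 0 → L' ≈L L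
  LLe⇒≈L atLe                         _   = at≈
  LLe⇒≈L (flipLe {k₁ = k₁} {k₂} _ _)  k≡0 = ⊥-elim (m+1+n≢0 (k₁ + k₂) k≡0)
  LLe⇒≈L (sameLe {k₁ = k₁} m l)       k≡0 =
    arr≈ (MLe⇒≈M m (m+n≡0⇒m≡0 k₁ k≡0)) (LLe⇒≈L l (m+n≡0⇒n≡0 k₁ k≡0))

  MLe⇒≈M : ∀ {p k M' M} → MLe p k M' M → k ≡ 0 → M' ≈M M
  MLe⇒≈M []Le                   _   = []≈
  MLe⇒≈M (∷Le {k₁ = k₁} l s m)  k≡0 =
    ∷≈ (LLe⇒≈L l (m+n≡0⇒m≡0 k₁ k≡0)) s (MLe⇒≈M m (m+n≡0⇒n≡0 k₁ k≡0))

≈M-refl : ∀ M → M ≈M M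
≈M-refl M = MLe⇒≈M (MLe-refl {⁺} M) refl

∷Leʳ : ∀ {p k₁ k₂ L' L M' M N'} → LLe p k₁ L' L → Select L' M' N' → MLe p k₂ N' M →
       MLe p (k₁ + k₂) M' (L ∷ M)
∷Leʳ l here      w = ∷Le l here w
∷Leʳ {k₁ = k₁} l (there s) (∷Le {k₁ = a} {k₂ = b} l₀ s₀ w) =
  MLe-cast (∷Le l₀ (there s₀) (∷Leʳ l s w)) (x∙yz≈y∙xz a k₁ b)

mutual
  LLe-sym : ∀ {p q k L' L} → LLe p k L' L → k ≡ 0 → LLe q 0 L L'
  LLe-sym atLe                        _   = atLe
  LLe-sym (flipLe {k₁ = k₁} {k₂} _ _) k≡0 = ⊥-elim (m+1+n≢0 (k₁ + k₂) k≡0)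
  LLe-sym (sameLe {k₁ = k₁} m l)      k≡0 =
    sameLe (MLe-sym m (m+n≡0⇒m≡0 k₁ k≡0)) (LLe-sym l (m+n≡0⇒n≡0 k₁ k≡0))

  MLe-sym : ∀ {p q k M' M} → MLe p k M' M → k ≡ 0 → MLe q 0 M M'
  MLe-sym []Le                  _   = []Le
  MLe-sym (∷Le {k₁ = k₁} l s w) k≡0 =
    ∷Leʳ (LLe-sym l (m+n≡0⇒m≡0 k₁ k≡0)) s (MLe-sym w (m+n≡0⇒n≡0 k₁ k≡0))

MLe-selectˡ : ∀ {p k L M M₀ N} → Select L M M₀ → MLe p k M N → MLe p k (L ∷ M₀) N
MLe-selectˡ here      w = w
MLe-selectˡ (there s) (∷Le {k₁ = a} l s₀ w) with MLe-selectˡ s w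
... | ∷Le {k₁ = b} {k₂ = c} l' s' w' with select-swap s₀ s'
...   | _ , s₁ , s₂ = MLe-cast (∷Le l' s₁ (∷Le l s₂ w')) (x∙yz≈y∙xz b a c)

record Partner (p : Pol) (k : ℕ) (M' : Multi) (L : Lin) (M : Multi) : Set where
  constructor partner
  field
    {L'}    : Lin
    {N'}    : Multi
    {k₁ k₂} : ℕ
    select  : Select L' M' N'
    head    : LLe p k₁ L' L
    rest    : MLe p k₂ N' M
    index   : k ≡ k₁ + k₂

MLe-partner : ∀ {p k M' N L M} → MLe p k M' N → Select L N M → Partner p k M' L M
MLe-partner []Le ()
MLe-partner (∷Le {k₁ = a} l s w) t with select-same-or-swap s t
... | inj₁ (refl , refl)  = partner here l w refl
... | inj₂ (_ , s' , t') with MLe-partner w s'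
...   | partner {k₁ = b} {c} u l' w' refl = partner (there u) l' (∷Le l t' w') (x∙yz≈y∙xz a b c)

mutual
  LLe-trans : ∀ {p k l L₁ L₂ L₃} → LLe p k L₁ L₂ → LLe p l L₂ L₃ → LLe p (k + l) L₁ L₃
  LLe-trans atLe atLe = atLe
  LLe-trans (flipLe {k₁ = a} {b} m l) (sameLe {k₁ = c} {d} m' l') =
    LLe-cast (flipLe (MLe-trans m m') (LLe-trans l l')) (solve (a ∷ b ∷ c ∷ d ∷ []))
  LLe-trans (sameLe {k₁ = a} {b} m l) (flipLe {k₁ = c} {d} m' l') =
    LLe-cast (flipLe (MLe-trans m m') (LLe-trans l l')) (solve (a ∷ b ∷ c ∷ d ∷ []))
  LLe-trans (sameLe {k₁ = a} {b} m l) (sameLe {k₁ = c} {d} m' l') =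
    LLe-cast (sameLe (MLe-trans m m') (LLe-trans l l')) (sym (interchange a b c d))

  MLe-trans : ∀ {p k l M₁ M₂ M₃} → MLe p k M₁ M₂ → MLe p l M₂ M₃ → MLe p (k + l) M₁ M₃
  MLe-trans []Le w = w
  MLe-trans (∷Le {k₁ = a} {b} l s w) w₂ with MLe-selectˡ s w₂
  ... | ∷Le {k₁ = c} {d} l' s' w' =
    MLe-cast (∷Le (LLe-trans l l') s' (MLe-trans w w')) (sym (interchange a b c d))

mutual
  LLe-diamond : ∀ p {e₁ e₂ L₁ L₂ L} → LLe p e₁ L₁ L → LLe (opp p) e₂ L₂ L →
                ∃[ L₀ ] (LLe (opp p) e₂ L₀ L₁ × LLe p e₁ L₀ L₂)
  LLe-diamond p atLe atLe = _ , atLe , atLe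
  LLe-diamond ⁺ (flipLe m l) (sameLe m' l')
    with MLe-diamond ⁻ m m' | LLe-diamond ⁺ l l'
  ... | M₀ , m₁ , m₂ | L₀ , l₁ , l₂ = arr M₀ ∘ L₀ , sameLe m₁ l₁ , flipLe m₂ l₂
  LLe-diamond ⁻ (sameLe m l) (flipLe m' l')
    with MLe-diamond ⁺ m m' | LLe-diamond ⁻ l l'
  ... | M₀ , m₁ , m₂ | L₀ , l₁ , l₂ = arr M₀ ∘ L₀ , flipLe m₁ l₁ , sameLe m₂ l₂
  LLe-diamond p (sameLe {c = c} m l) (sameLe m' l')
    with MLe-diamond (opp p) m m' | LLe-diamond p l l'
  ... | M₀ , m₁ , m₂ | L₀ , l₁ , l₂ = arr M₀ c L₀ , sameLe m₁ l₁ , sameLe m₂ l₂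

  MLe-diamond : ∀ p {e₁ e₂ M₁ M₂ M} → MLe p e₁ M₁ M → MLe (opp p) e₂ M₂ M →
                ∃[ M₀ ] (MLe (opp p) e₂ M₀ M₁ × MLe p e₁ M₀ M₂)
  MLe-diamond p []Le []Le = [] , []Le , []Le
  MLe-diamond p (∷Le l s w) w' with MLe-partner w' s
  ... | partner u l' w'' refl with LLe-diamond p l l' | MLe-diamond p w w''
  ...   | L₀ , l₁ , l₂ | M₀ , m₁ , m₂ = L₀ ∷ M₀ , ∷Le l₁ here m₁ , ∷Le l₂ u m₂

-- Black arrows

blackness : Color → ℕ
blackness ∘ = 0
blackness • = 1

mutual
  blacks : Lin → ℕ
  blacks (at _)      = 0
  blacks (arr M c L) = blacksᴹ M + blacks L + blackness c

  blacksᴹ : Multi → ℕ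
  blacksᴹ []      = 0
  blacksᴹ (L ∷ M) = blacks L + blacksᴹ M

blacksᴹ-select : ∀ {L M N} → Select L M N → blacksᴹ M ≡ blacks L + blacksᴹ N
blacksᴹ-select here = refl
blacksᴹ-select {L} (there {y = y} {ys = N} s) =
  trans (cong (blacks y +_) (blacksᴹ-select s)) (x∙yz≈y∙xz (blacks y) (blacks L) (blacksᴹ N))

mutual
  blacks-LLe : ∀ {p k L' L} → LLe p k L' L → blacks L' + k ≡ blacks L
  blacks-LLe atLe = refl
  blacks-LLe (flipLe {k₁ = k₁} {k₂} {M'} {L' = L'} m l) =
    trans (regroup (blacksᴹ M') (blacks L') k₁ k₂) (cong₂ (λ x y → x + y + 1) (blacksᴹ-MLe m) (blacks-LLe l))
    where
      regroup : ∀ a b k₁ k₂ → a + b + 0 + (k₁ + k₂ + 1) ≡ (a + k₁) + (b + k₂) + 1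
      regroup = solve-∀
  blacks-LLe (sameLe {k₁ = k₁} {k₂} {c} {M'} {L' = L'} m l) =
    trans (regroup (blacksᴹ M') (blacks L') (blackness c) k₁ k₂)
          (cong₂ (λ x y → x + y + blackness c) (blacksᴹ-MLe m) (blacks-LLe l))
    where
      regroup : ∀ a b x k₁ k₂ → a + b + x + (k₁ + k₂) ≡ (a + k₁) + (b + k₂) + x
      regroup = solve-∀

  blacksᴹ-MLe : ∀ {p k M' M} → MLe p k M' M → blacksᴹ M' + k ≡ blacksᴹ M
  blacksᴹ-MLe []Le = refl
  blacksᴹ-MLe (∷Le {k₁ = k₁} {k₂} {L'} {L} {M'} {M} {N'} l s w) = begin
    blacks L' + blacksᴹ M' + (k₁ + k₂) ≡⟨ interchange (blacks L') (blacksᴹ M') k₁ k₂ ⟩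
    (blacks L' + k₁) + (blacksᴹ M' + k₂) ≡⟨ cong₂ _+_ (blacks-LLe l) (blacksᴹ-MLe w) ⟩
    blacks L + blacksᴹ N'                ≡⟨ blacksᴹ-select s ⟨
    blacksᴹ M ∎
    where open ≡-Reasoning

blacksᴹ-< : ∀ {p k M' M} → MLe p (suc k) M' M → blacksᴹ M' < blacksᴹ M
blacksᴹ-< {M' = M'} w = subst (blacksᴹ M' <_) (blacksᴹ-MLe w) (m<m+n (blacksᴹ M') z<s)

MLe-++ : ∀ {p k₁ k₂ M₁ N₁ M₂ N₂} → MLe p k₁ M₁ N₁ → MLe p k₂ M₂ N₂ →
         MLe p (k₁ + k₂) (M₁ ++ M₂) (N₁ ++ N₂)
MLe-++ []Le w = w
MLe-++ {N₂ = N₂} (∷Le {k₁ = a} {b} l s w) w₂ =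
  MLe-cast (∷Le l (select-++ʳ N₂ s) (MLe-++ w w₂)) (sym (+-assoc a b _))

record MLeSplit (p : Pol) (k : ℕ) (M N₁ N₂ : Multi) : Set where
  constructor split
  field
    {M₁ M₂} : Multi
    {k₁ k₂} : ℕ
    left    : MLe p k₁ M₁ N₁
    right   : MLe p k₂ M₂ N₂
    index   : k ≡ k₁ + k₂
    reorder : ∀ q → MLe q 0 (M₁ ++ M₂) M

MLe-split : ∀ {p k M} N₁ {N₂} → MLe p k M (N₁ ++ N₂) → MLeSplit p k M N₁ N₂
MLe-split {M = M} [] w = split []Le w refl (λ q → MLe-refl M)
MLe-split (L ∷ N₁) w with MLe-partner w here
... | partner {L'} {k₁ = a} u l w' refl with MLe-split N₁ w'
...   | split {k₁ = b} left right refl reorder =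
  split (∷Le l here left) right (sym (+-assoc a b _))
        (λ q → MLe-sym (∷Leʳ (LLe-refl L') u (MLe-sym {q = q} (reorder q) refl)) refl)

-- Environments

sumBelow : ℕ → (ℕ → ℕ) → ℕ
sumBelow zero    f = 0
sumBelow (suc n) f = sumBelow n f + f n

sumBelow-cong : ∀ n {f g} → (∀ x → x < n → f x ≡ g x) → sumBelow n f ≡ sumBelow n g
sumBelow-cong zero    f≗g = refl
sumBelow-cong (suc n) f≗g = cong₂ _+_ (sumBelow-cong n (λ x x<n → f≗g x (m<n⇒m<1+n x<n))) (f≗g n ≤-refl)

sumBelow-zero : ∀ n → sumBelow n (λ _ → 0) ≡ 0
sumBelow-zero zero    = refl
sumBelow-zero (suc n) = trans (+-identityʳ _) (sumBelow-zero n)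

sumBelow-+ : ∀ n f g → sumBelow n (λ x → f x + g x) ≡ sumBelow n f + sumBelow n g
sumBelow-+ zero    f g = refl
sumBelow-+ (suc n) f g =
  trans (cong (_+ (f n + g n)) (sumBelow-+ n f g)) (interchange (sumBelow n f) (sumBelow n g) (f n) (g n))

sumBelow-extend : ∀ {n} m f → (∀ x → n ≤ x → f x ≡ 0) → n ≤ m → sumBelow m f ≡ sumBelow n f
sumBelow-extend zero    f f≡0 z≤n = refl
sumBelow-extend (suc m) f f≡0 n≤1+m with m≤n⇒m<n∨m≡n n≤1+m
... | inj₂ refl  = refl
... | inj₁ n<1+m =
  trans (cong₂ _+_ (sumBelow-extend m f f≡0 (≤-pred n<1+m)) (f≡0 m (≤-pred n<1+m))) (+-identityʳ _)

_[_↦_] : ∀ {X : Set} → (Var → X) → Var → X → Var → X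
(f [ x ↦ a ]) y with x ≟ y
... | yes _ = a
... | no  _ = f y

↦-same : ∀ {X : Set} (f : Var → X) x a → (f [ x ↦ a ]) x ≡ a
↦-same f x a with x ≟ x
... | yes _   = refl
... | no  x≢x = ⊥-elim (x≢x refl)

↦-other : ∀ {X : Set} (f : Var → X) {x a y} → x ≢ y → (f [ x ↦ a ]) y ≡ f y
↦-other f {x} {y = y} x≢y with x ≟ y
... | yes x≡y = ⊥-elim (x≢y x≡y)
... | no  _   = refl

∖-same : ∀ Γ x → (Γ ∖ x) x ≡ []
∖-same Γ x with x ≟ x
... | yes _   = refl
... | no  x≢x = ⊥-elim (x≢x refl)

∖-other : ∀ Γ {x y} → x ≢ y → (Γ ∖ x) y ≡ Γ y
∖-other Γ {x} {y} x≢y with x ≟ y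
... | yes x≡y = ⊥-elim (x≢y x≡y)
... | no  _   = refl

single-same : ∀ x L → single x L x ≡ L ∷ []
single-same x L with x ≟ x
... | yes _   = refl
... | no  x≢x = ⊥-elim (x≢x refl)

single-other : ∀ x L {y} → x ≢ y → single x L y ≡ []
single-other x L {y} x≢y with x ≟ y
... | yes x≡y = ⊥-elim (x≢y x≡y)
... | no  _   = refl

single∖ : ∀ x L y → (single x L ∖ x) y ≡ []
single∖ x L y with x ≟ y
... | yes _   = refl
... | no  x≢y = single-other x L x≢y

sumBelow-point : ∀ n {x} f → x < n → sumBelow n f ≡ sumBelow n (f [ x ↦ 0 ]) + f x
sumBelow-point (suc n) {x} f x<1+n with x ≟ n
... | yes refl = cong (_+ f x)
      (trans (sumBelow-cong n (λ y y<x → sym (↦-other f (λ x≡y → <⇒≢ y<x (sym x≡y))))) (sym (+-identityʳ _)))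
... | no x≢n = trans (cong (_+ f n) (sumBelow-point n f (≤∧≢⇒< (≤-pred x<1+n) x≢n))) (xy∙z≈xz∙y _ (f x) (f n))

MLe-emptyʳ : ∀ {p k M' M} → MLe p k M' M → M ≡ [] → M' ≡ [] × k ≡ 0
MLe-emptyʳ []Le         refl = refl , refl
MLe-emptyʳ (∷Le _ () _) refl

MLe-singletonʳ : ∀ {p k M' L} → MLe p k M' (L ∷ []) → ∃[ L' ] (M' ≡ L' ∷ [] × LLe p k L' L)
MLe-singletonʳ (∷Le {k₁ = k₁} l here []Le) = _ , refl , LLe-cast l (sym (+-identityʳ k₁))
MLe-singletonʳ (∷Le l (there ()) _)

FinSupp : Env → Set
FinSupp Γ = ∃[ n ] (∀ x → n ≤ x → Γ x ≡ [])

FinSupp-∅ : FinSupp ∅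
FinSupp-∅ = 0 , λ _ _ → refl

FinSupp-⊎ : ∀ {Γ Δ} → FinSupp Γ → FinSupp Δ → FinSupp (Γ ⊎ Δ)
FinSupp-⊎ (n , Γ≡[]) (m , Δ≡[]) =
  n ⊔ m , λ x n⊔m≤x → cong₂ _++_ (Γ≡[] x (m⊔n≤o⇒m≤o n m n⊔m≤x)) (Δ≡[] x (m⊔n≤o⇒n≤o n m n⊔m≤x))

-- EnvLe with the per-variable indices given as a function, so that it composes pointwise,
-- unlike the inductive EnvLeBelow.
record ELe (p : Pol) (k : ℕ) (Γ' Γ : Env) : Set where
  constructor mkELe
  field
    bound     : ℕ
    index     : Var → ℕ
    pointwise : ∀ x → MLe p (index x) (Γ' x) (Γ x)
    vanish    : ∀ x → bound ≤ x → Γ x ≡ []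
    total     : k ≡ sumBelow bound index

  vanishˡ : ∀ x → bound ≤ x → Γ' x ≡ []
  vanishˡ x b≤x = proj₁ (MLe-emptyʳ (pointwise x) (vanish x b≤x))

  total-beyond : ∀ m → bound ≤ m → k ≡ sumBelow m index
  total-beyond m b≤m =
    trans total (sym (sumBelow-extend m index (λ x b≤x → proj₂ (MLe-emptyʳ (pointwise x) (vanish x b≤x))) b≤m))

open ELe

ELe-refl : ∀ {p Γ} → FinSupp Γ → ELe p 0 Γ Γ
ELe-refl (n , Γ≡[]) = mkELe n (λ _ → 0) (λ x → MLe-refl _) Γ≡[] (sym (sumBelow-zero n))

≈E⇒ELe : ∀ {p Γ Γ'} → Γ ≈E Γ' → FinSupp Γ → ELe p 0 Γ' Γ
≈E⇒ELe Γ≈Γ' (n , Γ≡[]) =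
  mkELe n (λ _ → 0) (λ x → MLe-sym (≈M⇒MLe {⁺} (Γ≈Γ' x)) refl) Γ≡[] (sym (sumBelow-zero n))

ELe-cong : ∀ {p k Γ' Γ Δ' Δ} → (∀ x → Γ' x ≡ Δ' x) → (∀ x → Γ x ≡ Δ x) → ELe p k Γ' Γ → ELe p k Δ' Δ
ELe-cong {p} Γ'≗Δ' Γ≗Δ E =
  mkELe (bound E) (index E) (λ x → subst₂ (MLe p (index E x)) (Γ'≗Δ' x) (Γ≗Δ x) (pointwise E x))
        (λ x b≤x → trans (sym (Γ≗Δ x)) (vanish E x b≤x)) (total E)

ELe-zipWith : ∀ {p k₁ k₂ Γ₁ Γ₂ Δ₁ Δ₂ Θ₁ Θ₂} →
              (∀ {x i j} → MLe p i (Γ₁ x) (Γ₂ x) → MLe p j (Δ₁ x) (Δ₂ x) → MLe p (i + j) (Θ₁ x) (Θ₂ x)) →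
              (∀ {x} → Γ₂ x ≡ [] → Δ₂ x ≡ [] → Θ₂ x ≡ []) →
              ELe p k₁ Γ₁ Γ₂ → ELe p k₂ Δ₁ Δ₂ → ELe p (k₁ + k₂) Θ₁ Θ₂
ELe-zipWith f f[] E F =
  mkELe n (λ x → index E x + index F x) (λ x → f (pointwise E x) (pointwise F x))
        (λ x n≤x → f[] (vanish E x (m⊔n≤o⇒m≤o _ _ n≤x)) (vanish F x (m⊔n≤o⇒n≤o _ _ n≤x)))
        (trans (cong₂ _+_ (total-beyond E n (m≤m⊔n _ _)) (total-beyond F n (m≤n⊔m _ _)))
               (sym (sumBelow-+ n _ _)))
  where
    n : ℕ
    n = bound E ⊔ bound F

ELe-trans : ∀ {p k₁ k₂ Γ₁ Γ₂ Γ₃} → ELe p k₁ Γ₁ Γ₂ → ELe p k₂ Γ₂ Γ₃ → ELe p (k₁ + k₂) Γ₁ Γ₃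
ELe-trans = ELe-zipWith MLe-trans (λ _ Γ₃≡[] → Γ₃≡[])

ELe-⊎ : ∀ {p k₁ k₂ Γ' Γ Δ' Δ} → ELe p k₁ Γ' Γ → ELe p k₂ Δ' Δ → ELe p (k₁ + k₂) (Γ' ⊎ Δ') (Γ ⊎ Δ)
ELe-⊎ = ELe-zipWith MLe-++ (cong₂ _++_)

ELe-point : ∀ {p k M' M} → MLe p k M' M → ∀ x → ELe p k (∅ [ x ↦ M' ]) (∅ [ x ↦ M ])
ELe-point {p} {k} {M'} {M} w x = mkELe (suc x) weight at-y vanish-y total-x
  where
    weight : Var → ℕ
    weight = (λ _ → 0) [ x ↦ k ]
    at-y : ∀ y → MLe p (weight y) ((∅ [ x ↦ M' ]) y) ((∅ [ x ↦ M ]) y)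
    at-y y with x ≟ y
    ... | yes _ = w
    ... | no  _ = []Le
    vanish-y : ∀ y → suc x ≤ y → (∅ [ x ↦ M ]) y ≡ []
    vanish-y y x<y = ↦-other ∅ (<⇒≢ x<y)
    total-x : k ≡ sumBelow (suc x) weight
    total-x = sym (cong₂ _+_
      (trans (sumBelow-cong x (λ y y<x → ↦-other _ (λ x≡y → <⇒≢ y<x (sym x≡y)))) (sumBelow-zero x))
      (↦-same _ x k))

ELe-single : ∀ {p k L' L} → LLe p k L' L → ∀ x → ELe p k (single x L') (single x L)
ELe-single {k = k} {L'} {L} l x =
  ELe-cong (single-point L') (single-point L) (ELe-point (MLe-cast (∷Le l here []Le) (+-identityʳ k)) x)
  where
    single-point : ∀ L y → (∅ [ x ↦ L ∷ [] ]) y ≡ single x L y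
    single-point L y with x ≟ y
    ... | yes _ = refl
    ... | no  _ = refl

record ELeSplit (p : Pol) (k : ℕ) (Γ₁ Γ Δ : Env) : Set where
  constructor split
  field
    {Γ₁' Δ₁'} : Env
    {k₁ k₂}   : ℕ
    left      : ELe p k₁ Γ₁' Γ
    right     : ELe p k₂ Δ₁' Δ
    index     : k ≡ k₁ + k₂
    reorder   : ∀ q → ELe q 0 (Γ₁' ⊎ Δ₁') Γ₁

ELe-split : ∀ {p k Γ₁} Γ Δ → ELe p k Γ₁ (Γ ⊎ Δ) → ELeSplit p k Γ₁ Γ Δ
ELe-split {p} {Γ₁ = Γ₁} Γ Δ E = split
    (mkELe n (λ x → MLeSplit.k₁ (split-x x)) (λ x → MLeSplit.left (split-x x))
           (λ x n≤x → ++-conicalˡ (Γ x) (Δ x) (vanish E x n≤x)) refl)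
    (mkELe n (λ x → MLeSplit.k₂ (split-x x)) (λ x → MLeSplit.right (split-x x))
           (λ x n≤x → ++-conicalʳ (Γ x) (Δ x) (vanish E x n≤x)) refl)
    (trans (total E) (trans (sumBelow-cong n (λ x _ → MLeSplit.index (split-x x))) (sumBelow-+ n _ _)))
    (λ q → mkELe n (λ _ → 0) (λ x → MLeSplit.reorder (split-x x) q) (vanishˡ E) (sym (sumBelow-zero n)))
  where
    n : ℕ
    n = bound E
    split-x : ∀ x → MLeSplit p (index E x) (Γ₁ x) (Γ x) (Δ x)
    split-x x = MLe-split (Γ x) (pointwise E x)

record ELeAt (p : Pol) (k : ℕ) (Γ' Γ : Env) (x : Var) : Set where
  constructor split
  field
    {k₁ k₂} : ℕ
    without : ELe p k₁ (Γ' ∖ x) (Γ ∖ x)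
    at-x    : MLe p k₂ (Γ' x) (Γ x)
    index   : k ≡ k₁ + k₂

ELe-at : ∀ {p k Γ' Γ} → ELe p k Γ' Γ → ∀ x → ELeAt p k Γ' Γ x
ELe-at {p} {Γ' = Γ'} {Γ} E x =
  split (mkELe n (index E [ x ↦ 0 ]) at-y vanish-y refl) (pointwise E x)
        (trans (total-beyond E n (m≤m⊔n _ _)) (sumBelow-point n (index E) (m≤n⊔m (bound E) (suc x))))
  where
    n : ℕ
    n = bound E ⊔ suc x
    at-y : ∀ y → MLe p ((index E [ x ↦ 0 ]) y) ((Γ' ∖ x) y) ((Γ ∖ x) y)
    at-y y with x ≟ y
    ... | yes _ = []Le
    ... | no  _ = pointwise E y
    vanish-y : ∀ y → n ≤ y → (Γ ∖ x) y ≡ []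
    vanish-y y n≤y with x ≟ y
    ... | yes _ = refl
    ... | no  _ = vanish E y (m⊔n≤o⇒m≤o _ _ n≤y)

ELe-∅ʳ : ∀ {p k Γ' Γ} → ELe p k Γ' Γ → (∀ y → Γ y ≡ []) → k ≡ 0 × (∀ y → Γ' y ≡ [])
ELe-∅ʳ {Γ' = Γ'} E Γ≡[] =
  trans (total E) (trans (sumBelow-cong (bound E) (λ y _ → proj₂ (empty y))) (sumBelow-zero (bound E))) ,
  λ y → proj₁ (empty y)
  where
    empty : ∀ y → Γ' y ≡ [] × index E y ≡ 0
    empty y = MLe-emptyʳ (pointwise E y) (Γ≡[] y)

ELe-single⁻¹ : ∀ {p k Γ' x L} → ELe p k Γ' (single x L) →
               ∃[ L' ] ((∀ y → Γ' y ≡ single x L' y) × LLe p k L' L)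
ELe-single⁻¹ {p} {Γ' = Γ'} {x} {L} E with ELe-at E x
... | split {k₂ = k₂} without at-x refl
  with ELe-∅ʳ without (single∖ x L) | MLe-singletonʳ (subst (MLe p k₂ (Γ' x)) (single-same x L) at-x)
...   | refl , Γ'∖x≡[] | L' , Γ'x≡[L'] , l = L' , Γ'≗single , l
  where
    Γ'≗single : ∀ y → Γ' y ≡ single x L' y
    Γ'≗single y with x ≟ y
    ... | yes refl = Γ'x≡[L']
    ... | no  x≢y  = trans (sym (∖-other Γ' x≢y)) (Γ'∖x≡[] y)

ELe-diamond : ∀ p {e₁ e₂ Γ₁ Γ₂ Γ} → ELe p e₁ Γ₁ Γ → ELe (opp p) e₂ Γ₂ Γ →
              ∃[ Γ₀ ] (ELe (opp p) e₂ Γ₀ Γ₁ × ELe p e₁ Γ₀ Γ₂)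
ELe-diamond p {Γ₁ = Γ₁} {Γ₂} E F =
  (λ x → proj₁ (diamond x)) ,
  mkELe n (index F) (λ x → proj₁ (proj₂ (diamond x))) (λ x n≤x → vanishˡ E x (m⊔n≤o⇒m≤o _ _ n≤x))
        (total-beyond F n (m≤n⊔m _ _)) ,
  mkELe n (index E) (λ x → proj₂ (proj₂ (diamond x))) (λ x n≤x → vanishˡ F x (m⊔n≤o⇒n≤o _ _ n≤x))
        (total-beyond E n (m≤m⊔n _ _))
  where
    n : ℕ
    n = bound E ⊔ bound F
    diamond : ∀ x → ∃[ M₀ ] (MLe (opp p) (index F x) M₀ (Γ₁ x) × MLe p (index E x) M₀ (Γ₂ x))
    diamond x = MLe-diamond p (pointwise E x) (pointwise F x)

ELe⇒EnvLe : ∀ {p k Γ' Γ} → ELe p k Γ' Γ → EnvLe p k Γ' Γ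
ELe⇒EnvLe {p} {Γ' = Γ'} {Γ} E =
  bound E , subst (EnvLeBelow p Γ' Γ (bound E)) (sym (total E)) (below (bound E)) ,
  λ x b≤x → vanishˡ E x b≤x , vanish E x b≤x
  where
    below : ∀ m → EnvLeBelow p Γ' Γ m (sumBelow m (index E))
    below zero    = base
    below (suc m) = step (below m) (pointwise E m)

record IndexedBelow (p : Pol) (Γ' Γ : Env) (n k : ℕ) : Set where
  constructor indexed
  field
    index     : Var → ℕ
    pointwise : ∀ x → x < n → MLe p (index x) (Γ' x) (Γ x)
    beyond    : ∀ x → n ≤ x → index x ≡ 0
    total     : k ≡ sumBelow n index

EnvLeBelow⇒IndexedBelow : ∀ {p Γ' Γ n k} → EnvLeBelow p Γ' Γ n k → IndexedBelow p Γ' Γ n k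
EnvLeBelow⇒IndexedBelow base = indexed (λ _ → 0) (λ x ()) (λ _ _ → refl) refl
EnvLeBelow⇒IndexedBelow {p} {Γ'} {Γ} (step {n = n} {k₂ = k₂} below w)
  with EnvLeBelow⇒IndexedBelow below
... | indexed f pointwise-f beyond-f total-f =
  indexed (f [ n ↦ k₂ ]) pointwise-n beyond-n
          (cong₂ _+_ (trans total-f (sumBelow-cong n (λ x x<n → sym (↦-other f (>⇒≢ x<n)))))
                     (sym (↦-same f n k₂)))
  where
    pointwise-n : ∀ x → x < suc n → MLe p ((f [ n ↦ k₂ ]) x) (Γ' x) (Γ x)
    pointwise-n x x<1+n with n ≟ x
    ... | yes refl = w
    ... | no  n≢x  = pointwise-f x (≤∧≢⇒< (≤-pred x<1+n) (≢-sym n≢x))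
    beyond-n : ∀ x → suc n ≤ x → (f [ n ↦ k₂ ]) x ≡ 0
    beyond-n x n<x = trans (↦-other f (<⇒≢ n<x)) (beyond-f x (<⇒≤ n<x))

EnvLe⇒ELe : ∀ {p k Γ' Γ} → EnvLe p k Γ' Γ → ELe p k Γ' Γ
EnvLe⇒ELe {p} {Γ' = Γ'} {Γ} (n , below , vanish-n) with EnvLeBelow⇒IndexedBelow below
... | indexed f pointwise-f beyond-f total-f =
  mkELe n f pointwise-x (λ x n≤x → proj₂ (vanish-n x n≤x)) total-f
  where
    pointwise-x : ∀ x → MLe p (f x) (Γ' x) (Γ x)
    pointwise-x x with x <? n
    ... | yes x<n = pointwise-f x x<n
    ... | no  x≮n with vanish-n x (≮⇒≥ x≮n) | beyond-f x (≮⇒≥ x≮n)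
    ...   | Γ'x≡[] , Γx≡[] | fx≡0 rewrite Γ'x≡[] | Γx≡[] | fx≡0 = []Le

mutual
  ⊢-finSupp : ∀ {Γ k t L} → Γ ⊢[ k ] t ∶ L → FinSupp Γ
  ⊢-finSupp (ax {x = x} {L}) = suc x , λ y x<y → single-other x L (<⇒≢ x<y)
  ⊢-finSupp (abs {Γ = Γ} {x = x} D) with ⊢-finSupp D
  ... | n , Γ≡[] = n , λ y n≤y → ∖-vanish y (Γ≡[] y n≤y)
    where
      ∖-vanish : ∀ y → Γ y ≡ [] → (Γ ∖ x) y ≡ []
      ∖-vanish y Γy≡[] with x ≟ y
      ... | yes _ = refl
      ... | no  _ = Γy≡[]
  ⊢-finSupp (appT D Ds)   = FinSupp-⊎ (⊢-finSupp D) (⊢M-finSupp Ds)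
  ⊢-finSupp (conv D Γ≈Γ' _) with ⊢-finSupp D
  ... | n , Γ≡[] = n , λ y n≤y → []≈M (subst (_≈M _) (Γ≡[] y n≤y) (Γ≈Γ' y))
    where
      []≈M : ∀ {M} → [] ≈M M → M ≡ []
      []≈M []≈ = refl

  ⊢M-finSupp : ∀ {Γ k t M} → Γ ⊢M[ k ] t ∶ M → FinSupp Γ
  ⊢M-finSupp many[]        = FinSupp-∅
  ⊢M-finSupp (many∷ D Ds)  = FinSupp-⊎ (⊢-finSupp D) (⊢M-finSupp Ds)

-- Typing up to whitening

record Whitens (u : Term) (Γ₁ : Env) (L₁ : Lin) (B : ℕ) : Set where
  constructor whitens
  field
    {Γ₂}       : Env
    {L₂}       : Lin
    {k₂ f₁ f₂} : ℕ
    typing     : Γ₂ ⊢[ k₂ ] u ∶ L₂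
    env        : ELe ⁻ f₁ Γ₂ Γ₁
    type       : LLe ⁺ f₂ L₂ L₁
    budget     : k₂ + (f₁ + f₂) ≤ B

record Whitensᴹ (u : Term) (Γ₁ : Env) (M₁ : Multi) (B : ℕ) : Set where
  constructor whitensᴹ
  field
    {Γ₂}       : Env
    {M₂}       : Multi
    {k₂ f₁ f₂} : ℕ
    typing     : Γ₂ ⊢M[ k₂ ] u ∶ M₂
    env        : ELe ⁻ f₁ Γ₂ Γ₁
    type       : MLe ⁺ f₂ M₂ M₁
    budget     : k₂ + (f₁ + f₂) ≤ B

Whitens-weaken : ∀ {u Γ₁ L₁ B B'} → B ≤ B' → Whitens u Γ₁ L₁ B → Whitens u Γ₁ L₁ B'
Whitens-weaken B≤B' (whitens D E l c) = whitens D E l (≤-trans c B≤B')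

Whitens-trans : ∀ {u Γ₁ L₁ Γ₀ L₀ B g h} → Whitens u Γ₁ L₁ B → ELe ⁻ g Γ₁ Γ₀ → LLe ⁺ h L₁ L₀ →
                Whitens u Γ₀ L₀ (B + (g + h))
Whitens-trans {B = B} {g} {h} (whitens {k₂ = k₂} {f₁} {f₂} D E l c) F m =
  whitens D (ELe-trans E F) (LLe-trans l m) (begin
    k₂ + ((f₁ + g) + (f₂ + h)) ≡⟨ cong (k₂ +_) (interchange f₁ g f₂ h) ⟩
    k₂ + ((f₁ + f₂) + (g + h)) ≡⟨ +-assoc k₂ (f₁ + f₂) (g + h) ⟨
    k₂ + (f₁ + f₂) + (g + h)   ≤⟨ +-monoˡ-≤ (g + h) c ⟩
    B + (g + h)                ∎)
  where open ≤-Reasoning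

Covers : Term → Env → ℕ → Lin → Set
Covers u Γ k L = ∀ {Γ₁ L₁ e₁ e₂} → ELe ⁺ e₁ Γ₁ Γ → LLe ⁻ e₂ L₁ L → Whitens u Γ₁ L₁ (k + (e₁ + e₂))

Coversᴹ : Term → Env → ℕ → Multi → Set
Coversᴹ u Γ k M = ∀ {Γ₁ M₁ e₁ e₂} → ELe ⁺ e₁ Γ₁ Γ → MLe ⁻ e₂ M₁ M → Whitensᴹ u Γ₁ M₁ (k + (e₁ + e₂))

_⊑ʷ_ : Term → Term → Set
t ⊑ʷ u = ∀ {Γ k L} → Γ ⊢[ k ] t ∶ L → Covers u Γ k L

_⊑ʷᴹ_ : Term → Term → Set
t ⊑ʷᴹ u = ∀ {Γ k M} → Γ ⊢M[ k ] t ∶ M → Coversᴹ u Γ k M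

Covers-≈ : ∀ {u Γ Γ' k L L'} → FinSupp Γ → Γ ≈E Γ' → L ≈L L' → Covers u Γ k L → Covers u Γ' k L'
Covers-≈ {k = k} Γ-fin Γ≈Γ' L≈L' cover {e₁ = e₁} {e₂} E l =
  Whitens-weaken (≤-reflexive (drop-zeros k e₁ e₂))
    (cover (ELe-trans E (≈E⇒ELe Γ≈Γ' Γ-fin)) (LLe-trans l (LLe-sym (≈L⇒LLe {⁺} L≈L') refl)))
  where
    drop-zeros : ∀ k e₁ e₂ → k + ((e₁ + 0) + (e₂ + 0)) ≡ k + (e₁ + e₂)
    drop-zeros = solve-∀

⊑ʷ-var : ∀ {x} → var x ⊑ʷ var x
⊑ʷ-var (conv {k = k} D Γ≈Γ' L≈L') = Covers-≈ {k = k} (⊢-finSupp D) Γ≈Γ' L≈L' (⊑ʷ-var D)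
⊑ʷ-var {x} ax {e₁ = e₁} {e₂} E l with ELe-single⁻¹ E
... | L' , Γ₁≗single , L'≤L with LLe-diamond ⁺ L'≤L l
...   | L₀ , L₀≤L' , L₀≤L₁ =
  whitens ax (ELe-cong (λ _ → refl) (λ y → sym (Γ₁≗single y)) (ELe-single L₀≤L' x)) L₀≤L₁
          (≤-reflexive (+-comm e₂ e₁))

extend-removed : ∀ Γ x y → ((Γ ∖ x) ⊎ (∅ [ x ↦ Γ x ])) y ≡ Γ y
extend-removed Γ x y with x ≟ y
... | yes refl = refl
... | no  _    = ++-identityʳ (Γ y)

remove-extended : ∀ Γ x M → Γ x ≡ [] → ∀ y → ((Γ ⊎ (∅ [ x ↦ M ])) ∖ x) y ≡ Γ y
remove-extended Γ x M Γx≡[] y with x ≟ y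
... | yes refl = sym Γx≡[]
... | no  x≢y  = trans (cong (Γ y ++_) (↦-other ∅ x≢y)) (++-identityʳ (Γ y))

extended-at : ∀ Γ x M → Γ x ≡ [] → (Γ ⊎ (∅ [ x ↦ M ])) x ≡ M
extended-at Γ x M Γx≡[] = cong₂ _++_ Γx≡[] (↦-same ∅ x M)

⊑ʷ-lam : ∀ {c x t u} → t ⊑ʷ u → lam c x t ⊑ʷ lam c x u
⊑ʷ-lam t⊑u (conv {k = k} D Γ≈Γ' L≈L') = Covers-≈ {k = k} (⊢-finSupp D) Γ≈Γ' L≈L' (⊑ʷ-lam t⊑u D)
⊑ʷ-lam {x = x} t⊑u (abs {Γ = Γ} {k = k} D) {Γ₁} {e₁ = e₁}
       E (sameLe {k₁ = y₁} {k₂ = y₂} {M' = M₁} M₁≤Γx L₁≤L)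
  with t⊑u D (ELe-cong (λ _ → refl) (extend-removed Γ x) (ELe-⊎ E (ELe-point M₁≤Γx x))) L₁≤L
... | whitens {k₂ = k₂} {f₂ = f₂} D' E' L₂≤L₁ c with ELe-at E' x
...   | split {k₁ = z₁} {z₂} without at-x refl =
  whitens (abs D') (ELe-cong (λ _ → refl) (remove-extended Γ₁ x M₁ Γ₁x≡[]) without)
          (sameLe (subst (MLe ⁻ z₂ _) (extended-at Γ₁ x M₁ Γ₁x≡[]) at-x) L₂≤L₁) (begin
    k₂ + (z₁ + (z₂ + f₂))   ≡⟨ cong (k₂ +_) (+-assoc z₁ z₂ f₂) ⟨
    k₂ + ((z₁ + z₂) + f₂)   ≤⟨ c ⟩
    k + ((e₁ + y₁) + y₂)    ≡⟨ cong (k +_) (+-assoc e₁ y₁ y₂) ⟩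
    k + (e₁ + (y₁ + y₂))    ∎)
  where
    open ≤-Reasoning
    Γ₁x≡[] : Γ₁ x ≡ []
    Γ₁x≡[] = proj₁ (MLe-emptyʳ (pointwise E x) (∖-same Γ x))

⊑ʷ⇒⊑ʷᴹ : ∀ {t u} → t ⊑ʷ u → t ⊑ʷᴹ u
⊑ʷ⇒⊑ʷᴹ t⊑u many[] E []Le with ELe-∅ʳ E (λ _ → refl)
... | refl , Γ₁≡[] = whitensᴹ many[] (ELe-cong (λ _ → refl) (λ y → sym (Γ₁≡[] y)) (ELe-refl FinSupp-∅)) []Le z≤n
⊑ʷ⇒⊑ʷᴹ t⊑u (many∷ {Γ = Γ} {Δ} {k₁ = k} {k'} D Ds) E w with ELe-split Γ Δ E
... | split {k₁ = x} {x'} E₁ E₂ refl reorder with MLe-partner w here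
...   | partner {k₁ = j} {j'} u l w' refl with t⊑u D E₁ l | ⊑ʷ⇒⊑ʷᴹ t⊑u Ds E₂ w'
...     | whitens {k₂ = k₂} {f₁} {f₂} D' E₁' l' c | whitensᴹ {k₂ = k₂'} {f₁'} {f₂'} Ds' E₂' w'' c' =
  whitensᴹ (many∷ D' Ds') (ELe-trans (ELe-⊎ E₁' E₂') (reorder ⁻)) (∷Le l' u w'') (begin
    (k₂ + k₂') + (((f₁ + f₁') + 0) + (f₂ + f₂'))  ≡⟨ regroup k₂ f₁ f₂ k₂' f₁' f₂' ⟩
    (k₂ + (f₁ + f₂)) + (k₂' + (f₁' + f₂'))        ≤⟨ +-mono-≤ c c' ⟩
    (k + (x + j)) + (k' + (x' + j'))              ≡⟨ regroup k x j k' x' j' ⟨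
    (k + k') + (((x + x') + 0) + (j + j'))        ≡⟨ cong (λ z → k + k' + (z + (j + j'))) (+-identityʳ (x + x')) ⟩
    (k + k') + ((x + x') + (j + j'))              ∎)
  where
    open ≤-Reasoning
    regroup : ∀ a b c a' b' c' → (a + a') + (((b + b') + 0) + (c + c')) ≡ (a + (b + c)) + (a' + (b' + c'))
    regroup = solve-∀

-- Whitening the function's arrow from • to ∘ may make the application one step dearer;
-- the extra unit δ of the whitening index pays for it.
data ArrowLe⁺ (k : ℕ) : Lin → Multi → Color → Lin → Set where
  arrowLe : ∀ {k₁ k₂ δ M' c' L' M c L} → MLe ⁻ k₁ M' M → LLe ⁺ k₂ L' L → k ≡ k₁ + k₂ + δ →
            (∀ d → cost c' d ≤ cost c d + δ) → ArrowLe⁺ k (arr M' c' L') M c L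

cost-∘≤cost-•+1 : ∀ d → cost ∘ d ≤ cost • d + 1
cost-∘≤cost-•+1 ∘ = z≤n
cost-∘≤cost-•+1 • = ≤-refl

LLe⁺-arr : ∀ {k A M c L} → LLe ⁺ k A (arr M c L) → ArrowLe⁺ k A M c L
LLe⁺-arr (flipLe m l) = arrowLe m l refl cost-∘≤cost-•+1
LLe⁺-arr (sameLe m l) = arrowLe m l (sym (+-identityʳ _)) (λ d → m≤m+n _ 0)

-- Once the domain of the function and the type of the argument differ, whiten each in turn against
-- the other; each step with a positive index lowers the number of • arrows, so the alternation stops.
module Alignment (d : Color) {a s : Term} (a⊑a : a ⊑ʷ a) (s⊑s : s ⊑ʷᴹ s) where

  aligned : ∀ {Γ Δ ka ks M M' c L} → Γ ⊢[ ka ] a ∶ arr M c L → Δ ⊢M[ ks ] s ∶ M' → MLe ⁻ 0 M M' →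
            Whitens (app d a s) (Γ ⊎ Δ) L (ka + ks + cost c d + 0)
  aligned {Γ} {L = L} Da Ds w =
    whitens (appT (conv Da (λ y → ≈M-refl (Γ y)) (LLe⇒≈L (sameLe {p = ⁺} w (LLe-refl L)) refl)) Ds)
            (ELe-refl (FinSupp-⊎ (⊢-finSupp Da) (⊢M-finSupp Ds))) (LLe-refl L) ≤-refl

  mutual
    whiten-argument : ∀ {Γ Δ ka ks M M' c L m} → Acc _<_ (blacksᴹ M') →
                      Γ ⊢[ ka ] a ∶ arr M c L → Δ ⊢M[ ks ] s ∶ M' → MLe ⁻ m M M' →
                      Whitens (app d a s) (Γ ⊎ Δ) L (ka + ks + cost c d + m)
    whiten-argument {m = zero} _ Da Ds w = aligned Da Ds w
    whiten-argument {ka = ka} {ks} {c = c} {L = L} {suc m} (acc smaller) Da Ds w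
      with s⊑s Ds (ELe-refl (⊢M-finSupp Ds)) w
    ... | whitensᴹ {k₂ = ks'} {g} {m'} Ds' E w' c' =
      Whitens-weaken (budget ka ks ks' (cost c d) m m' g c')
        (Whitens-trans (whiten-function (smaller (blacksᴹ-< w)) Da Ds' w') (ELe-⊎ (ELe-refl (⊢-finSupp Da)) E)
                       (LLe-refl L))
      where
        budget : ∀ ka ks ks' C m m' g → ks' + (g + m') ≤ ks + (0 + suc m) →
                 ka + ks' + C + m' + (g + 0) ≤ ka + ks + C + suc m
        budget ka ks ks' C m m' g c' = begin
          ka + ks' + C + m' + (g + 0) ≡⟨ solve (ka ∷ ks' ∷ C ∷ m' ∷ g ∷ []) ⟩
          ka + C + (ks' + (g + m'))   ≤⟨ +-monoʳ-≤ (ka + C) c' ⟩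
          ka + C + (ks + (0 + suc m)) ≡⟨ solve (ka ∷ C ∷ ks ∷ m ∷ []) ⟩
          ka + ks + C + suc m         ∎
          where open ≤-Reasoning

    whiten-function : ∀ {Γ Δ ka ks M M' c L m} → Acc _<_ (blacksᴹ M) →
                      Γ ⊢[ ka ] a ∶ arr M c L → Δ ⊢M[ ks ] s ∶ M' → MLe ⁺ m M' M →
                      Whitens (app d a s) (Γ ⊎ Δ) L (ka + ks + cost c d + m)
    whiten-function {m = zero} _ Da Ds w = aligned Da Ds (MLe-sym w refl)
    whiten-function {ka = ka} {ks} {c = c} {L = L} {suc m} (acc smaller) Da Ds w
      with a⊑a Da (ELe-refl (⊢-finSupp Da)) (sameLe w (LLe-refl L))
    ... | whitens {k₂ = ka'} {g} Da' E l c' with LLe⁺-arr l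
    ...   | arrowLe {k₁} {k₂} {δ} {c' = c''} dom cod refl recolor =
      Whitens-weaken (budget ka ka' ks (cost c d) (cost c'' d) m g k₁ k₂ δ (recolor d) c')
        (Whitens-trans (whiten-argument (smaller (blacksᴹ-< w)) Da' Ds dom)
                       (ELe-⊎ E (ELe-refl (⊢M-finSupp Ds))) cod)
      where
        budget : ∀ ka ka' ks C C' m g k₁ k₂ δ → C' ≤ C + δ → ka' + (g + (k₁ + k₂ + δ)) ≤ ka + (0 + (suc m + 0)) →
                 ka' + ks + C' + k₁ + ((g + 0) + k₂) ≤ ka + ks + C + suc m
        budget ka ka' ks C C' m g k₁ k₂ δ C'≤C+δ c' = begin
          ka' + ks + C' + k₁ + ((g + 0) + k₂)       ≤⟨ +-monoˡ-≤ _ (+-monoˡ-≤ k₁ (+-monoʳ-≤ (ka' + ks) C'≤C+δ)) ⟩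
          ka' + ks + (C + δ) + k₁ + ((g + 0) + k₂)  ≡⟨ solve (ka' ∷ ks ∷ C ∷ δ ∷ k₁ ∷ g ∷ k₂ ∷ []) ⟩
          ka' + (g + (k₁ + k₂ + δ)) + (ks + C)      ≤⟨ +-monoˡ-≤ (ks + C) c' ⟩
          ka + (0 + (suc m + 0)) + (ks + C)         ≡⟨ solve (ka ∷ m ∷ ks ∷ C ∷ []) ⟩
          ka + ks + C + suc m                       ∎
          where open ≤-Reasoning

⊑ʷ-app : ∀ {d a a' s s'} → a ⊑ʷ a' → s ⊑ʷᴹ s' → a' ⊑ʷ a' → s' ⊑ʷᴹ s' → app d a s ⊑ʷ app d a' s'
⊑ʷ-app a⊑a' s⊑s' a'⊑a' s'⊑s' (conv {k = k} D Γ≈Γ' L≈L') =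
  Covers-≈ {k = k} (⊢-finSupp D) Γ≈Γ' L≈L' (⊑ʷ-app a⊑a' s⊑s' a'⊑a' s'⊑s' D)
⊑ʷ-app {d} a⊑a' s⊑s' a'⊑a' s'⊑s' (appT {Γ = Γ} {Δ} {k₁ = ka} {ks} {c} {M = M} Da Ds) {e₂ = e₂} E l
  with ELe-split Γ Δ E
... | split {k₁ = x₁} {x₂} E₁ E₂ refl reorder with s⊑s' Ds E₂ (MLe-refl M)
...   | whitensᴹ {k₂ = ks'} {g₁} {g₂} Ds' F₂ w cg with a⊑a' Da E₁ (sameLe w l)
...     | whitens {k₂ = ka'} {h₁} Da' F₁ l' ch with LLe⁺-arr l'
...       | arrowLe {k₁ = j₁} {j₂} {δ} {c' = c'} dom cod refl recolor =
  Whitens-weaken (budget ka ka' ks ks' (cost c d) (cost c' d) x₁ x₂ e₂ g₁ g₂ h₁ j₁ j₂ δ (recolor d) ch cg)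
    (Whitens-trans (whiten-argument (<-wellFounded _) Da' Ds' dom) (ELe-trans (ELe-⊎ F₁ F₂) (reorder ⁻)) cod)
  where
    open Alignment d a'⊑a' s'⊑s'
    budget : ∀ ka ka' ks ks' C C' x₁ x₂ e₂ g₁ g₂ h₁ j₁ j₂ δ → C' ≤ C + δ →
             ka' + (h₁ + (j₁ + j₂ + δ)) ≤ ka + (x₁ + (g₂ + e₂)) → ks' + (g₁ + g₂) ≤ ks + (x₂ + 0) →
             ka' + ks' + C' + j₁ + (((h₁ + g₁) + 0) + j₂) ≤ ka + ks + C + ((x₁ + x₂) + e₂)
    budget ka ka' ks ks' C C' x₁ x₂ e₂ g₁ g₂ h₁ j₁ j₂ δ C'≤C+δ ch cg = +-cancelʳ-≤ g₂ _ _ (begin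
      ka' + ks' + C' + j₁ + (((h₁ + g₁) + 0) + j₂) + g₂
        ≤⟨ +-monoˡ-≤ g₂ (+-monoˡ-≤ _ (+-monoˡ-≤ j₁ (+-monoʳ-≤ (ka' + ks') C'≤C+δ))) ⟩
      ka' + ks' + (C + δ) + j₁ + (((h₁ + g₁) + 0) + j₂) + g₂
        ≡⟨ solve (ka' ∷ ks' ∷ C ∷ δ ∷ j₁ ∷ h₁ ∷ g₁ ∷ j₂ ∷ g₂ ∷ []) ⟩
      (ka' + (h₁ + (j₁ + j₂ + δ))) + (ks' + (g₁ + g₂)) + C
        ≤⟨ +-monoˡ-≤ C (+-mono-≤ ch cg) ⟩
      (ka + (x₁ + (g₂ + e₂))) + (ks + (x₂ + 0)) + C
        ≡⟨ solve (ka ∷ x₁ ∷ g₂ ∷ e₂ ∷ ks ∷ x₂ ∷ C ∷ []) ⟩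
      ka + ks + C + ((x₁ + x₂) + e₂) + g₂ ∎)
      where open ≤-Reasoning

⊑ʷ-refl : ∀ t → t ⊑ʷ t
⊑ʷ-refl (var x)     = ⊑ʷ-var
⊑ʷ-refl (lam c x t) = ⊑ʷ-lam (⊑ʷ-refl t)
⊑ʷ-refl (app d a s) = ⊑ʷ-app (⊑ʷ-refl a) (⊑ʷ⇒⊑ʷᴹ (⊑ʷ-refl s)) (⊑ʷ-refl a) (⊑ʷ⇒⊑ʷᴹ (⊑ʷ-refl s))

⊑ʷ-plug : ∀ C {t u} → t ⊑ʷ u → plug C t ⊑ʷ plug C u
⊑ʷ-plug hole         t⊑u = t⊑u
⊑ʷ-plug (lamC c x C) t⊑u = ⊑ʷ-lam (⊑ʷ-plug C t⊑u)
⊑ʷ-plug (appL d C s) t⊑u =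
  ⊑ʷ-app (⊑ʷ-plug C t⊑u) (⊑ʷ⇒⊑ʷᴹ (⊑ʷ-refl s)) (⊑ʷ-refl _) (⊑ʷ⇒⊑ʷᴹ (⊑ʷ-refl s))
⊑ʷ-plug (appR d a C) t⊑u =
  ⊑ʷ-app (⊑ʷ-refl a) (⊑ʷ⇒⊑ʷᴹ (⊑ʷ-plug C t⊑u)) (⊑ʷ-refl a) (⊑ʷ⇒⊑ʷᴹ (⊑ʷ-refl _))

⊑pwc⇒⊑ʷ : ∀ {t u} → t ⊑pwc u → t ⊑ʷ u
⊑pwc⇒⊑ʷ {u = u} t⊑u {Γ} {k} {L} D {e₁ = e₁} {e₂} E l with t⊑u Γ L k D
... | _ , _ , k' , _ , D' , pairLe {k₁ = d₁} {d₂} Γ'≤Γ L'≤L , k'+d≤k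
  with ELe-diamond ⁻ (EnvLe⇒ELe Γ'≤Γ) E | LLe-diamond ⁺ L'≤L l
... | _ , Γ₀≤Γ' , Γ₀≤Γ₁ | _ , L₀≤L' , L₀≤L₁ =
  Whitens-weaken budget (Whitens-trans (⊑ʷ-refl u D' Γ₀≤Γ' L₀≤L') Γ₀≤Γ₁ L₀≤L₁)
  where
    open ≤-Reasoning
    budget : k' + (e₁ + e₂) + (d₁ + d₂) ≤ k + (e₁ + e₂)
    budget = begin
      k' + (e₁ + e₂) + (d₁ + d₂) ≡⟨ xy∙z≈xz∙y k' (e₁ + e₂) (d₁ + d₂) ⟩
      k' + (d₁ + d₂) + (e₁ + e₂) ≤⟨ +-monoˡ-≤ (e₁ + e₂) k'+d≤k ⟩
      k + (e₁ + e₂)              ∎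

⊑ʷ⇒⊑pwc : ∀ {t u} → t ⊑ʷ u → t ⊑pwc u
⊑ʷ⇒⊑pwc t⊑u Γ L k D with t⊑u D (ELe-refl (⊢-finSupp D)) (LLe-refl L)
... | whitens {Γ₂} {L₂} {k₂} {f₁} {f₂} D' E l c =
  Γ₂ , L₂ , k₂ , f₁ + f₂ , D' , pairLe (ELe⇒EnvLe E) l , subst (k₂ + (f₁ + f₂) ≤_) (+-identityʳ k) c

proposition4 : (t u : Term) → t ⊑pwc u → (C : Ctx) → plug C t ⊑pwc plug C u
proposition4 t u t⊑u C = ⊑ʷ⇒⊑pwc (⊑ʷ-plug C (⊑pwc⇒⊑ʷ t⊑u))
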